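{- Let $H$ be a graph with $V(H)=\{u_1,u_2,u_3,u_4\}$ such that $u_1u_2\notin E(H)$ and $u_3u_4\notin E(H)$, and suppose $H+u_1u_2$ is isomorphic to $H+u_3u_4$. Then at least one of the permutations $\sigma_1=(u_1u_4)(u_2u_3)$ or $\sigma_2=(u_1u_3)(u_2u_4)$ of $V(H)$ is an isomorphism from $H+u_1u_2$ to $H+u_3u_4$.
   Context: Graphs are simple and undirected; $H+xy$ denotes $H$ with the edge $xy$ added. A permutation written in cycle notation acts on the vertex set. -}

module Defs where

open import Data.Bool using (Bool; true; false; _∨_; _∧_)
open import Data.Nat using (ℕ)
open import Data.Fin using (Fin; zero; suc; _≟_)
open import Data.Product using (Σ; _×_; _,_)
open import Function.Definitions using (Bijective)
open import Relation.Binary.PropositionalEquality using (_≡_)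
open import Relation.Nullary.Decidable using (⌊_⌋)

record Graph (n : ℕ) : Set where
  field
    adj   : Fin n → Fin n → Bool
    sym   : ∀ a b → adj a b ≡ adj b a
    loopless : ∀ a → adj a a ≡ false
open Graph public

-- H + xy : add the edge xy (for x ≠ y this is again a simple graph).
_+E_ : ∀ {n} → Graph n → Fin n × Fin n → Fin n → Fin n → Bool
(H +E (x , y)) a b =
  adj H a b ∨ (⌊ a ≟ x ⌋ ∧ ⌊ b ≟ y ⌋) ∨ (⌊ a ≟ y ⌋ ∧ ⌊ b ≟ x ⌋)

IsIso : ∀ {n} → (Fin n → Fin n → Bool) → (Fin n → Fin n → Bool) → (Fin n → Fin n) → Set
IsIso A B f = Bijective _≡_ _≡_ f × (∀ a b → A a b ≡ B (f a) (f b))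

Isomorphic : ∀ {n} → (Fin n → Fin n → Bool) → (Fin n → Fin n → Bool) → Set
Isomorphic {n} A B = Σ (Fin n → Fin n) (IsIso A B)

u₁ u₂ u₃ u₄ : Fin 4
u₁ = zero
u₂ = suc zero
u₃ = suc (suc zero)
u₄ = suc (suc (suc zero))

σ₁ : Fin 4 → Fin 4
σ₁ zero = u₄
σ₁ (suc zero) = u₃
σ₁ (suc (suc zero)) = u₂
σ₁ (suc (suc (suc zero))) = u₁

σ₂ : Fin 4 → Fin 4
σ₂ zero = u₃
σ₂ (suc zero) = u₄
σ₂ (suc (suc zero)) = u₁
σ₂ (suc (suc (suc zero))) = u₂

-- Without the edges u₁u₂ and u₃u₄, H is determined by its four edges between
-- {u₁,u₂} and {u₃,u₄}, say p = u₁u₃, q = u₁u₄, r = u₂u₃, s = u₂u₄.  Since σ₁ and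
-- σ₂ map u₁u₂ to u₃u₄, σ₁ is an isomorphism as soon as p = s and σ₂ as soon as
-- q = r.  Otherwise s = ¬p and r = ¬q, and then one of the two graphs is a
-- triangle plus an isolated vertex and the other a star K₁,₃; they are not
-- isomorphic, because exactly one of them contains a triangle.
module Submission where

open import Defs hiding (sym)
open import Data.Bool using (Bool; true; false; not; T; _∨_; _∧_)
open import Data.Bool.Properties using (¬-not) renaming (_≟_ to _≟ᵇ_)
open import Data.Empty using (⊥-elim)
open import Data.Fin using (Fin; zero; suc; _≟_)
open import Data.Fin.Properties using (any?)
open import Data.Nat using (ℕ)
open import Data.Product using (∃; _×_; _,_; proj₁; proj₂)
open import Data.Sum as Sum using (_⊎_; inj₁; inj₂)
open import Data.Vec using (Vec; []; _∷_; lookup)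
open import Function using (_∘_)
open import Function.Consequences.Propositional
  using (inverseᵇ⇒bijective; strictlyInverseˡ⇒inverseˡ; strictlyInverseʳ⇒inverseʳ)
open import Function.Definitions using (Bijective)
open import Relation.Binary.PropositionalEquality
  using (_≡_; _≢_; refl; sym; trans; cong; subst)
open import Relation.Nullary using (¬_; Dec; yes; no; does; contradiction)
open import Relation.Nullary.Decidable using (⌊_⌋; T?; _×-dec_)

private
  variable
    n : ℕ

Adj : ℕ → Set
Adj n = Fin n → Fin n → Bool

_≐_ : Adj n → Adj n → Set
A ≐ B = ∀ a b → A a b ≡ B a b

-- _+E_ on bare adjacency relations: H +E e is definitionally adj H +ᵉ e.
_+ᵉ_ : Adj n → Fin n × Fin n → Adj n
(A +ᵉ (x , y)) a b = A a b ∨ (⌊ a ≟ x ⌋ ∧ ⌊ b ≟ y ⌋) ∨ (⌊ a ≟ y ⌋ ∧ ⌊ b ≟ x ⌋)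

+ᵉ-resp-≐ : ∀ {A B : Adj n} e → A ≐ B → (A +ᵉ e) ≐ (B +ᵉ e)
+ᵉ-resp-≐ (x , y) A≐B a b =
  cong (λ t → t ∨ (⌊ a ≟ x ⌋ ∧ ⌊ b ≟ y ⌋) ∨ (⌊ a ≟ y ⌋ ∧ ⌊ b ≟ x ⌋)) (A≐B a b)

IsIso-resp-≐ : ∀ {A A′ B B′ : Adj n} {f} → A ≐ A′ → B ≐ B′ → IsIso A B f → IsIso A′ B′ f
IsIso-resp-≐ {f = f} A≐A′ B≐B′ (bij , pres) =
  bij , λ a b → trans (sym (A≐A′ a b)) (trans (pres a b) (B≐B′ (f a) (f b)))

involution⇒bijective : ∀ {A : Set} {f : A → A} → (∀ x → f (f x) ≡ x) → Bijective _≡_ _≡_ f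
involution⇒bijective {f = f} ff≗id =
  inverseᵇ⇒bijective (strictlyInverseˡ⇒inverseˡ f ff≗id , strictlyInverseʳ⇒inverseʳ f ff≗id)

Triangle : Adj n → Set
Triangle A = ∃ λ a → ∃ λ b → ∃ λ c → T (A a b) × T (A b c) × T (A a c)

triangle? : (A : Adj n) → Dec (Triangle A)
triangle? A = any? λ a → any? λ b → any? λ c → T? (A a b) ×-dec T? (A b c) ×-dec T? (A a c)

hasTriangle : Adj n → Bool
hasTriangle A = does (triangle? A)

IsIso-preserves-Triangle : ∀ {A B : Adj n} {f} → IsIso A B f → Triangle A → Triangle B
IsIso-preserves-Triangle {f = f} (_ , pres) (a , b , c , ab , bc , ac) =
  f a , f b , f c , subst T (pres a b) ab , subst T (pres b c) bc , subst T (pres a c) ac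

IsIso-reflects-Triangle : ∀ {A B : Adj n} {f} → IsIso A B f → Triangle B → Triangle A
IsIso-reflects-Triangle {A = A} {B} {f} ((_ , surj) , pres) (x , y , z , xy , yz , xz)
  with preimage x | preimage y | preimage z
  where
  preimage : ∀ v → ∃ λ u → f u ≡ v
  preimage v = proj₁ (surj v) , proj₂ (surj v) refl
... | a , refl | b , refl | c , refl = a , b , c , edge xy , edge yz , edge xz
  where
  edge : ∀ {u v} → T (B (f u) (f v)) → T (A u v)
  edge {u} {v} = subst T (sym (pres u v))

IsIso⇒hasTriangle-≡ : ∀ {A B : Adj n} {f} → IsIso A B f → hasTriangle A ≡ hasTriangle B
IsIso⇒hasTriangle-≡ {A = A} {B} iso with triangle? A | triangle? B
... | yes _  | yes _  = refl
... | no  _  | no  _  = refl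
... | yes tA | no ¬tB = contradiction (IsIso-preserves-Triangle iso tA) ¬tB
... | no ¬tA | yes tB = contradiction (IsIso-reflects-Triangle iso tB) ¬tA

∀-Fin4 : ∀ {P : Fin 4 → Set} → P u₁ → P u₂ → P u₃ → P u₄ → ∀ a → P a
∀-Fin4 p₁ p₂ p₃ p₄ zero = p₁
∀-Fin4 p₁ p₂ p₃ p₄ (suc zero) = p₂
∀-Fin4 p₁ p₂ p₃ p₄ (suc (suc zero)) = p₃
∀-Fin4 p₁ p₂ p₃ p₄ (suc (suc (suc zero))) = p₄

crossAdj : Bool → Bool → Bool → Bool → Adj 4
crossAdj p q r s a b = lookup (lookup matrix a) b
  where
  matrix : Vec (Vec Bool 4) 4
  matrix = (false ∷ false ∷ p     ∷ q     ∷ [])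
         ∷ (false ∷ false ∷ r     ∷ s     ∷ [])
         ∷ (p     ∷ r     ∷ false ∷ false ∷ [])
         ∷ (q     ∷ s     ∷ false ∷ false ∷ [])
         ∷ []

adj≐crossAdj : (H : Graph 4) → adj H u₁ u₂ ≡ false → adj H u₃ u₄ ≡ false →
  adj H ≐ crossAdj (adj H u₁ u₃) (adj H u₁ u₄) (adj H u₂ u₃) (adj H u₂ u₄)
adj≐crossAdj H ¬u₁u₂ ¬u₃u₄ = ∀-Fin4
  (∀-Fin4 (loopless H u₁) ¬u₁u₂ refl refl)
  (∀-Fin4 (trans (Graph.sym H u₂ u₁) ¬u₁u₂) (loopless H u₂) refl refl)
  (∀-Fin4 (Graph.sym H u₃ u₁) (Graph.sym H u₃ u₂) (loopless H u₃) ¬u₃u₄)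
  (∀-Fin4 (Graph.sym H u₄ u₁) (Graph.sym H u₄ u₂) (trans (Graph.sym H u₄ u₃) ¬u₃u₄) (loopless H u₄))

σ₁-isIso : ∀ p q r → IsIso (crossAdj p q r p +ᵉ (u₁ , u₂)) (crossAdj p q r p +ᵉ (u₃ , u₄)) σ₁
σ₁-isIso p q r =
  involution⇒bijective (∀-Fin4 refl refl refl refl) ,
  ∀-Fin4 (∀-Fin4 refl refl refl refl) (∀-Fin4 refl refl refl refl)
         (∀-Fin4 refl refl refl refl) (∀-Fin4 refl refl refl refl)

σ₂-isIso : ∀ p q s → IsIso (crossAdj p q q s +ᵉ (u₁ , u₂)) (crossAdj p q q s +ᵉ (u₃ , u₄)) σ₂
σ₂-isIso p q s =
  involution⇒bijective (∀-Fin4 refl refl refl refl) ,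
  ∀-Fin4 (∀-Fin4 refl refl refl refl) (∀-Fin4 refl refl refl refl)
         (∀-Fin4 refl refl refl refl) (∀-Fin4 refl refl refl refl)

crossAdj-¬isomorphic : ∀ p q →
  ¬ Isomorphic (crossAdj p q (not q) (not p) +ᵉ (u₁ , u₂)) (crossAdj p q (not q) (not p) +ᵉ (u₃ , u₄))
crossAdj-¬isomorphic p q (_ , iso) =
  differs p q (IsIso⇒hasTriangle-≡ {A = X +ᵉ (u₁ , u₂)} {B = X +ᵉ (u₃ , u₄)} iso)
  where
  X : Adj 4
  X = crossAdj p q (not q) (not p)
  -- each case is settled by evaluating the decision procedure triangle?
  differs : ∀ p q → hasTriangle (crossAdj p q (not q) (not p) +ᵉ (u₁ , u₂))
                      ≢ hasTriangle (crossAdj p q (not q) (not p) +ᵉ (u₃ , u₄))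
  differs false false ()
  differs false true  ()
  differs true  false ()
  differs true  true  ()

crossAdj-σ₁⊎σ₂ : ∀ p q r s →
  Isomorphic (crossAdj p q r s +ᵉ (u₁ , u₂)) (crossAdj p q r s +ᵉ (u₃ , u₄)) →
  IsIso (crossAdj p q r s +ᵉ (u₁ , u₂)) (crossAdj p q r s +ᵉ (u₃ , u₄)) σ₁ ⊎
  IsIso (crossAdj p q r s +ᵉ (u₁ , u₂)) (crossAdj p q r s +ᵉ (u₃ , u₄)) σ₂
crossAdj-σ₁⊎σ₂ p q r s iso₁₂ with p ≟ᵇ s | q ≟ᵇ r
... | yes refl | _        = inj₁ (σ₁-isIso p q r)
... | no _     | yes refl = inj₂ (σ₂-isIso p q s)
... | no p≢s   | no q≢r   with ¬-not (p≢s ∘ sym) | ¬-not (q≢r ∘ sym)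
...   | refl | refl = ⊥-elim (crossAdj-¬isomorphic p q iso₁₂)

lemma3p8 : (H : Graph 4) → adj H u₁ u₂ ≡ false → adj H u₃ u₄ ≡ false →
    Isomorphic (H +E (u₁ , u₂)) (H +E (u₃ , u₄)) →
    IsIso (H +E (u₁ , u₂)) (H +E (u₃ , u₄)) σ₁ ⊎ IsIso (H +E (u₁ , u₂)) (H +E (u₃ , u₄)) σ₂
lemma3p8 H ¬u₁u₂ ¬u₃u₄ (f , iso) =
  Sum.map (IsIso-resp-≐ (back (u₁ , u₂)) (back (u₃ , u₄)))
          (IsIso-resp-≐ (back (u₁ , u₂)) (back (u₃ , u₄)))
          (crossAdj-σ₁⊎σ₂ _ _ _ _
            (f , IsIso-resp-≐ (+ᵉ-resp-≐ (u₁ , u₂) H≐X) (+ᵉ-resp-≐ (u₃ , u₄) H≐X) iso))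
  where
  X : Adj 4
  X = crossAdj (adj H u₁ u₃) (adj H u₁ u₄) (adj H u₂ u₃) (adj H u₂ u₄)
  H≐X : adj H ≐ X
  H≐X = adj≐crossAdj H ¬u₁u₂ ¬u₃u₄
  back : ∀ e → (X +ᵉ e) ≐ (adj H +ᵉ e)
  back e = +ᵉ-resp-≐ e (λ a b → sym (H≐X a b))
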